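{- Let $\rho:S_n\to\mathbb N$ be a vote tally such that $\operatorname{supp}(\rho)$ is a Condorcet domain of tiling type, i.e. $\operatorname{supp}(\rho)=\operatorname{Pre}(C)$ for some permutation $w\in S_n$ and some commutation class $C$ of reduced words for $w$. Then the majority relation $\triangleleft_\rho$ is a prelinear order with only simple ties.
   Context: For $w=(w_1,\dots,w_n)\in S_n$ (one-line notation), $<_w$ denotes the linear order $w_1<_w w_2<_w\cdots<_w w_n$ on $[n]=\{1,\dots,n\}$, and $\operatorname{Inv}(w)=\{(a,b):1\le a<b\le n,\ b<_w a\}$. Let $s_i$ ($1\le i\le n-1$) be the adjacent transposition of $i,i+1$; products are taken so that $ws_i$ is obtained from $w$ by swapping the entries in positions $i$ and $i+1$. A reduced word for $w$ is a sequence $(i_1,\dots,i_\ell)$ with $w=s_{i_1}\cdots s_{i_\ell}$ and $\ell=|\operatorname{Inv}(w)|$. The commutation class $C=C(\mathbf i)$ of a reduced word $\mathbf i$ is the set of words obtainable from $\mathbf i$ by repeatedly swapping two adjacent entries differing by at least $2$. The Condorcet domain of tiling type $\operatorname{Pre}(C)$ is the set of all permutations $s_{i'_1}\cdots s_{i'_m}$ ($0\le m\le \ell$) such that $(i'_1,\dots,i'_m)$ is a prefix of some word in $C$. A vote tally is a function $\rho:S_n\to\mathbb N=\{0,1,2,\dots\}$, with $\operatorname{supp}(\rho)=\{w:\rho(w)>0\}$. Its (strict) majority relation is the binary relation on $[n]$ given by $a\triangleleft_\rho b$ iff $\sum_{w\in S_n:\,a<_w b}\rho(w)>\sum_{w\in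 S_n:\,b<_w a}\rho(w)$. A binary relation $\prec$ on $[n]$ is a prelinear order if there is an ordered set partition $(B_1,\dots,B_m)$ of $[n]$ such that $a\prec b$ iff $a\in B_r$, $b\in B_s$ with $r<s$; it has only simple ties if every $|B_r|\le 2$. -}

module Defs where

open import Data.Nat as ℕ using (ℕ; zero; suc; _≤_; _<_)
open import Data.Fin as Fin using (Fin)
open import Data.Fin.Properties using (any?)
import Data.Fin.Properties as FinP
open import Data.Bool using (Bool; T)
import Data.Bool.ListAction as BL
import Data.Nat.ListAction as NL
open import Data.Vec as Vec using (Vec; []; _∷_; lookup)
open import Data.List as List using (List; []; _∷_; _++_; length)
open import Data.List.Relation.Unary.All using (All)
open import Data.List.Membership.Propositional using (_∈_)
open import Data.List.Relation.Binary.Permutation.Propositional using (_↭_)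
open import Data.Product using (Σ; ∃; ∃-syntax; _×_; _,_; proj₁)
open import Data.Product.Properties using ()
open import Relation.Nullary using (Dec; yes; no; ¬_)
open import Relation.Nullary.Decidable using (⌊_⌋; _×-dec_; T?)
open import Relation.Binary.PropositionalEquality using (_≡_)
open import Relation.Binary.Construct.Closure.ReflexiveTransitive using (Star)
open import Function.Bundles using (_⇔_)

-- Permutations of [n] in one-line notation.
-- The element i+1 of [n] is represented by (i : Fin n); a permutation
-- w = (w_1,…,w_n) is a vector of length n whose entries are all of [n].

isPermᵇ : ∀ {n} → Vec (Fin n) n → Bool
isPermᵇ {n} v =
  BL.all (λ i → BL.any (λ j → ⌊ i Fin.≟ j ⌋) (Vec.toList v)) (List.allFin n)

S : ℕ → Set
S n = Σ (Vec (Fin n) n) (λ v → T (isPermᵇ v))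

_<[_]_ : ∀ {n} → Fin n → Vec (Fin n) n → Fin n → Set
a <[ w ] b = ∃[ i ] ∃[ j ] (i Fin.< j × lookup w i ≡ a × lookup w j ≡ b)

<[]-dec : ∀ {n} (a : Fin n) (w : Vec (Fin n) n) (b : Fin n) → Dec (a <[ w ] b)
<[]-dec a w b = any? (λ i → any? (λ j →
  (i Fin.<? j) ×-dec ((lookup w i Fin.≟ a) ×-dec (lookup w j Fin.≟ b))))

allVecs : ∀ {n} (k : ℕ) → List (Vec (Fin n) k)
allVecs zero    = Vec.[] ∷ []
allVecs {n} (suc k) =
  List.concatMap (λ x → List.map (x ∷_) (allVecs k)) (List.allFin n)

keepPerms : ∀ {n} → List (Vec (Fin n) n) → List (S n)
keepPerms [] = []
keepPerms (v ∷ vs) with T? (isPermᵇ v)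
... | yes p = (v , p) ∷ keepPerms vs
... | no _  = keepPerms vs

allPerms : (n : ℕ) → List (S n)
allPerms n = keepPerms (allVecs n)

VoteTally : ℕ → Set
VoteTally n = S n → ℕ

votes : ∀ {n} → VoteTally n → Fin n → Fin n → ℕ
votes {n} ρ a b =
  NL.sum (List.map ρ (List.filter (λ w → <[]-dec a (proj₁ w) b) (allPerms n)))

Majority : ∀ {n} → VoteTally n → Fin n → Fin n → Set
Majority ρ a b = votes ρ b a < votes ρ a b

swapAt : ∀ {A : Set} {m} → Vec A m → ℕ → Vec A m
swapAt (x ∷ y ∷ xs) zero    = y ∷ x ∷ xs
swapAt (x ∷ xs)     (suc k) = x ∷ swapAt xs k
swapAt xs           _       = xs

-- w s_i : swap entries in (1-indexed) positions i and i+1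
_·s_ : ∀ {n} → Vec (Fin n) n → ℕ → Vec (Fin n) n
w ·s i = swapAt w (i ℕ.∸ 1)

idPerm : (n : ℕ) → Vec (Fin n) n
idPerm n = Vec.allFin n

eval : (n : ℕ) → List ℕ → Vec (Fin n) n
eval n = List.foldl _·s_ (idPerm n)

ValidWord : ℕ → List ℕ → Set
ValidWord n = All (λ i → 1 ≤ i × suc i ≤ n)

Inv-dec : ∀ {n} (w : Vec (Fin n) n) (p : Fin n × Fin n) →
          Dec (let (a , b) = p in a Fin.< b × b <[ w ] a)
Inv-dec w (a , b) = (a Fin.<? b) ×-dec <[]-dec b w a

invCount : ∀ {n} → Vec (Fin n) n → ℕ
invCount {n} w =
  length (List.filter (Inv-dec w) (List.cartesianProduct (List.allFin n) (List.allFin n)))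

ReducedWord : ∀ {n} → Vec (Fin n) n → List ℕ → Set
ReducedWord {n} w is = ValidWord n is × eval n is ≡ w × length is ≡ invCount w

FarApart : ℕ → ℕ → Set
FarApart i j = suc (suc i) ≤ j ⊎' suc (suc j) ≤ i
  where
  open import Data.Sum using () renaming (_⊎_ to _⊎'_)

data CommStep : List ℕ → List ℕ → Set where
  comm : ∀ u v i j → FarApart i j →
         CommStep (u ++ i ∷ j ∷ v) (u ++ j ∷ i ∷ v)

InCommClass : List ℕ → List ℕ → Set
InCommClass i j = Star CommStep i j

InPre : (n : ℕ) → List ℕ → Vec (Fin n) n → Set
InPre n 𝐢 u = ∃[ j ] ∃[ p ] ∃[ q ] (InCommClass 𝐢 j × j ≡ p ++ q × eval n p ≡ u)

record OrderedSetPartition (n : ℕ) : Set where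
  field
    blocks   : List (List (Fin n))
    nonempty : All (λ B → ¬ (B ≡ [])) blocks
    covers   : List.concat blocks ↭ List.allFin n

open OrderedSetPartition public

Induced : ∀ {n} → OrderedSetPartition n → Fin n → Fin n → Set
Induced P a b = ∃[ r ] ∃[ s ]
  (r Fin.< s × a ∈ List.lookup (blocks P) r × b ∈ List.lookup (blocks P) s)

IsPrelinear : ∀ {n} → (Fin n → Fin n → Set) → Set
IsPrelinear {n} R = ∃[ P ] (∀ a b → R a b ⇔ Induced {n} P a b)

IsPrelinearSimpleTies : ∀ {n} → (Fin n → Fin n → Set) → Set
IsPrelinearSimpleTies {n} R =
  ∃[ P ] ((∀ a b → R a b ⇔ Induced {n} P a b) × All (λ B → length B ≤ 2) (blocks P))

module Submission where

-- Every letter of a reduced word creates exactly one new inversion.  Hence, for a triple a < b < c,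
-- the prefixes of a reduced word restrict to a walk up one of the two maximal chains
-- abc < bac < bca < cba or abc < acb < cab < cba of the weak order on the triple, and a commutation
-- move changes a single intermediate state, which stays sandwiched on the same chain: all of Pre(C)
-- lies on one chain for each triple.  Along that chain the voters inverting the first, middle and
-- last pair form nested electorates, and prefix closure provides a voter strictly between any two
-- nonempty stages.  So the majority on the triple reverses an initial segment of the chain and ties
-- at most one pair; that is, it is negatively transitive and no three alternatives carry two ties.
-- Ranking alternatives by the number of alternatives beating them then yields the
-- ordered set partition, with blocks of size at most two.

open import Defs
open import Data.Nat using (ℕ; _>_)
open import Data.List using (List)
open import Data.Vec using (Vec)
open import Data.Fin using (Fin)
open import Data.Product using (proj₁)
open import Function.Bundles using (_⇔_)

open import Data.Nat as ℕ using (zero; suc; _∸_; _+_; _≤_; _<_; _<?_; z≤n; s≤s; s≤s⁻¹)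
open import Data.Nat.Properties as ℕₚ
  using (≤-refl; ≤-trans; ≤-reflexive; <-≤-trans; ≤-<-trans; ≮⇒≥; ≤-antisym; <-asym; <-irrefl;
         n≤1+n; +-identityʳ; +-suc; +-monoˡ-≤; +-monoʳ-≤; m≤n+m; m≤m+n; m<n+m)
open import Data.Nat.ListAction using (sum)
open import Data.Bool using (T)
open import Data.Bool.Properties using (T-irrelevant)
open import Data.Fin as Fin using ()
open import Data.Fin.Properties as Finₚ using (<-cmp)
open import Data.Vec as Vec using ([]; _∷_)
open import Data.Vec.Properties using (lookup-allFin)
open import Data.Vec.Membership.Propositional using () renaming (_∈_ to _∈ᵥ_)
open import Data.Vec.Membership.Propositional.Properties using (∈-allFin⁺; ∈-toList⁺)
open import Data.Vec.Relation.Unary.Any using (here; there)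
open import Data.Vec.Relation.Unary.All as Allᵥ using () renaming (_∷_ to _∷ᵥ_)
open import Data.Vec.Relation.Unary.AllPairs using () renaming (_∷_ to _∷ᵥ_)
open import Data.Vec.Relation.Unary.Unique.Propositional using () renaming (Unique to Uniqueᵥ)
open import Data.Vec.Relation.Unary.Unique.Propositional.Properties using (tabulate⁺)
open import Data.List as List using ([]; _∷_; _++_; map; filter; concat; foldl; length; upTo)
open import Data.List.Properties
  using (length-++; foldl-++; ++-assoc; filter-none; filter-accept; filter-reject; length-filter; length-tabulate)
open import Data.List.Scans.Base using (scanl)
open import Data.List.Membership.Propositional using (_∈_; _∉_)
open import Data.List.Membership.Propositional.Properties
  using (∈-allFin; ∈-cartesianProduct⁺; ∈-map⁺; ∈-concatMap⁺; ∈-concat⁻; ∈-filter⁻; ∈-upTo⁺; ∈-lookup)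
open import Data.List.Relation.Unary.Any as Any using (Any; here; there)
open import Data.List.Relation.Unary.Any.Properties using (any⁺; lookup-index)
open import Data.List.Relation.Unary.All as All using (All; []; _∷_)
open import Data.List.Relation.Unary.All.Properties as Allₚ using (++⁺; ++⁻; all⁻; all-filter)
open import Data.List.Relation.Unary.AllPairs as AllPairs using (AllPairs; []; _∷_)
open import Data.List.Relation.Unary.AllPairs.Properties as AllPairsₚ using (applyUpTo⁺₁; tabulate⁺-<)
open import Data.List.Relation.Unary.Unique.Propositional using (Unique)
open import Data.List.Relation.Unary.Unique.Propositional.Properties using (allFin⁺; cartesianProduct⁺; upTo⁺)
open import Data.List.Relation.Binary.Permutation.Propositional using (_↭_; prep; ↭-sym; ↭-trans; ↭-reflexive)
open import Data.List.Relation.Binary.Permutation.Propositional.Properties using (++⁺ˡ; shift; ∈-resp-↭)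
open import Data.Product using (∃; ∃₂; ∃-syntax; _×_; _,_; proj₂)
open import Data.Sum using (_⊎_; inj₁; inj₂; [_,_]; swap)
open import Data.Empty using (⊥; ⊥-elim)
open import Relation.Nullary using (¬_; Dec; yes; no)
open import Relation.Nullary.Decidable using (⌊_⌋; fromWitness; T?; decidable-stable)
open import Relation.Nullary.Negation using (contradiction)
open import Relation.Unary using (Decidable)
open import Relation.Binary using (tri<; tri≈; tri>)
open import Relation.Binary.Construct.Closure.ReflexiveTransitive using (ε; _◅_)
open import Relation.Binary.PropositionalEquality
  using (_≡_; _≢_; refl; sym; trans; cong; cong₂; subst; subst₂; module ≡-Reasoning)
open import Function using (id; _∘_; flip)
open import Function.Bundles using (mk⇔; Equivalence)
open Equivalence using (to; from)

module _ {A : Set} where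

  data Precedes (x y : A) : ∀ {m} → Vec A m → Set where
    now   : ∀ {m} {xs : Vec A m} → y ∈ᵥ xs → Precedes x y (x ∷ xs)
    later : ∀ {m z} {xs : Vec A m} → Precedes x y xs → Precedes x y (z ∷ xs)

  private variable
    m : ℕ
    x y z p q : A
    xs ys : Vec A m

  precedes-∈ʳ : Precedes x y xs → y ∈ᵥ xs
  precedes-∈ʳ (now y∈)  = there y∈
  precedes-∈ʳ (later b) = there (precedes-∈ʳ b)

  private
    ∉-head : Allᵥ.All (x ≢_) xs → ¬ x ∈ᵥ xs
    ∉-head (x≢y ∷ᵥ _) (here refl) = x≢y refl
    ∉-head (_ ∷ᵥ x∉)  (there x∈)  = ∉-head x∉ x∈

  precedes-asym : Uniqueᵥ xs → Precedes x y xs → ¬ Precedes y x xs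
  precedes-asym (x∉ ∷ᵥ _) (now y∈)  (now _)    = ∉-head x∉ y∈
  precedes-asym (x∉ ∷ᵥ _) (now _)   (later b)  = ∉-head x∉ (precedes-∈ʳ b)
  precedes-asym (y∉ ∷ᵥ _) (later b) (now _)    = ∉-head y∉ (precedes-∈ʳ b)
  precedes-asym (_ ∷ᵥ u)  (later b) (later b′) = precedes-asym u b b′

  precedes-trans : Uniqueᵥ xs → Precedes x y xs → Precedes y z xs → Precedes x z xs
  precedes-trans (x∉ ∷ᵥ _) (now y∈)  (now _)    = ⊥-elim (∉-head x∉ y∈)
  precedes-trans _         (now _)   (later b)  = now (precedes-∈ʳ b)
  precedes-trans (y∉ ∷ᵥ _) (later b) (now _)    = ⊥-elim (∉-head y∉ (precedes-∈ʳ b))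
  precedes-trans (_ ∷ᵥ u)  (later b) (later b′) = later (precedes-trans u b b′)

  precedes-total : x ≢ y → x ∈ᵥ xs → y ∈ᵥ xs → Precedes x y xs ⊎ Precedes y x xs
  precedes-total x≢y (here refl) (here refl) = ⊥-elim (x≢y refl)
  precedes-total x≢y (here refl) (there y∈)  = inj₁ (now y∈)
  precedes-total x≢y (there x∈)  (here refl) = inj₂ (now x∈)
  precedes-total x≢y (there x∈)  (there y∈)  with precedes-total x≢y x∈ y∈
  ... | inj₁ b = inj₁ (later b)
  ... | inj₂ b = inj₂ (later b)

  private
    ∈⇒lookup : y ∈ᵥ xs → ∃[ j ] Vec.lookup xs j ≡ y
    ∈⇒lookup (here refl) = Fin.zero , refl
    ∈⇒lookup (there y∈) with j , e ← ∈⇒lookup y∈ = Fin.suc j , e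

    lookup-∈ : ∀ (xs : Vec A m) j → Vec.lookup xs j ∈ᵥ xs
    lookup-∈ (_ ∷ _)  Fin.zero    = here refl
    lookup-∈ (_ ∷ xs) (Fin.suc j) = there (lookup-∈ xs j)

  Positions : A → A → Vec A m → Set
  Positions x y xs = ∃[ i ] ∃[ j ] (i Fin.< j × Vec.lookup xs i ≡ x × Vec.lookup xs j ≡ y)

  precedes⇔positions : Precedes x y xs ⇔ Positions x y xs
  precedes⇔positions = mk⇔ precedes⇒positions positions⇒precedes
    where
    precedes⇒positions : Precedes x y xs → Positions x y xs
    precedes⇒positions (now y∈) with j , e ← ∈⇒lookup y∈ = Fin.zero , Fin.suc j , s≤s z≤n , refl , e
    precedes⇒positions (later b) with i , j , i<j , e₁ , e₂ ← precedes⇒positions b =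
      Fin.suc i , Fin.suc j , s≤s i<j , e₁ , e₂
    positions⇒precedes : Positions x y xs → Precedes x y xs
    positions⇒precedes {xs = _ ∷ xs} (Fin.zero , Fin.suc j , _ , refl , refl) = now (lookup-∈ xs j)
    positions⇒precedes {xs = _ ∷ _} (Fin.suc i , Fin.suc j , s≤s i<j , e₁ , e₂) =
      later (positions⇒precedes (i , j , i<j , e₁ , e₂))

  data AdjacentSwap : ∀ {m} → Vec A m → Vec A m → A → A → Set where
    here  : ∀ {m p q} {xs : Vec A m} → AdjacentSwap (p ∷ q ∷ xs) (q ∷ p ∷ xs) p q
    there : ∀ {m p q z} {xs ys : Vec A m} → AdjacentSwap xs ys p q → AdjacentSwap (z ∷ xs) (z ∷ ys) p q

  swapAt-cases : ∀ (xs : Vec A m) k → swapAt xs k ≡ xs ⊎ ∃₂ (AdjacentSwap xs (swapAt xs k))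
  swapAt-cases []           k       = inj₁ refl
  swapAt-cases (x ∷ [])     zero    = inj₁ refl
  swapAt-cases (x ∷ [])     (suc k) = inj₁ refl
  swapAt-cases (x ∷ y ∷ xs) zero    = inj₂ (x , y , here)
  swapAt-cases (x ∷ y ∷ xs) (suc k) with swapAt-cases (y ∷ xs) k
  ... | inj₁ e           = inj₁ (cong (x ∷_) e)
  ... | inj₂ (p , q , s) = inj₂ (p , q , there s)

  swapAt-suc : ∀ x (xs : Vec A m) k → swapAt (x ∷ xs) (suc k) ≡ x ∷ swapAt xs k
  swapAt-suc x []      k = refl
  swapAt-suc x (_ ∷ _) k = refl

  swapAt-comm : ∀ (xs : Vec A m) k i → suc (suc k) ≤ i → swapAt (swapAt xs k) i ≡ swapAt (swapAt xs i) k
  swapAt-comm []               k       i             _         = refl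
  swapAt-comm (x ∷ [])         zero    (suc i)       _         = refl
  swapAt-comm (x ∷ y ∷ xs)     zero    (suc zero)    (s≤s ())
  swapAt-comm (x ∷ y ∷ [])     zero    (suc (suc i)) _         = refl
  swapAt-comm (x ∷ y ∷ z ∷ xs) zero    (suc (suc i)) _         = refl
  swapAt-comm (x ∷ xs)         (suc k) (suc i)       (s≤s k<i) = begin
    swapAt (swapAt (x ∷ xs) (suc k)) (suc i) ≡⟨ cong (λ v → swapAt v (suc i)) (swapAt-suc x xs k) ⟩
    swapAt (x ∷ swapAt xs k) (suc i)         ≡⟨ swapAt-suc x _ i ⟩
    x ∷ swapAt (swapAt xs k) i               ≡⟨ cong (x ∷_) (swapAt-comm xs k i k<i) ⟩
    x ∷ swapAt (swapAt xs i) k               ≡⟨ sym (swapAt-suc x _ k) ⟩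
    swapAt (x ∷ swapAt xs i) (suc k)         ≡⟨ cong (λ v → swapAt v (suc k)) (sym (swapAt-suc x xs i)) ⟩
    swapAt (swapAt (x ∷ xs) (suc i)) (suc k) ∎
    where open ≡-Reasoning

  adjacentSwap-sym : AdjacentSwap xs ys p q → AdjacentSwap ys xs q p
  adjacentSwap-sym here      = here
  adjacentSwap-sym (there s) = there (adjacentSwap-sym s)

  adjacentSwap-∈ : AdjacentSwap xs ys p q → z ∈ᵥ xs → z ∈ᵥ ys
  adjacentSwap-∈ here      (here e)           = there (here e)
  adjacentSwap-∈ here      (there (here e))   = here e
  adjacentSwap-∈ here      (there (there z∈)) = there (there z∈)
  adjacentSwap-∈ (there s) (here e)           = here e
  adjacentSwap-∈ (there s) (there z∈)         = there (adjacentSwap-∈ s z∈)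

  adjacentSwap-All : ∀ {P : A → Set} → AdjacentSwap xs ys p q → Allᵥ.All P xs → Allᵥ.All P ys
  adjacentSwap-All here      (pp ∷ᵥ pq ∷ᵥ pxs) = pq ∷ᵥ pp ∷ᵥ pxs
  adjacentSwap-All (there s) (pz ∷ᵥ pxs)       = pz ∷ᵥ adjacentSwap-All s pxs

  adjacentSwap-unique : AdjacentSwap xs ys p q → Uniqueᵥ xs → Uniqueᵥ ys
  adjacentSwap-unique here      ((p≢q ∷ᵥ p∉) ∷ᵥ (q∉ ∷ᵥ u)) = ((p≢q ∘ sym) ∷ᵥ q∉) ∷ᵥ (p∉ ∷ᵥ u)
  adjacentSwap-unique (there s) (z∉ ∷ᵥ u)                 = adjacentSwap-All s z∉ ∷ᵥ adjacentSwap-unique s u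

  adjacentSwap-≢ : Uniqueᵥ xs → AdjacentSwap xs ys p q → p ≢ q
  adjacentSwap-≢ ((p≢q ∷ᵥ _) ∷ᵥ _) here      = p≢q
  adjacentSwap-≢ (_ ∷ᵥ u)          (there s) = adjacentSwap-≢ u s

  adjacentSwap-swapped : AdjacentSwap xs ys p q → Precedes q p ys
  adjacentSwap-swapped here      = now (here refl)
  adjacentSwap-swapped (there s) = later (adjacentSwap-swapped s)

  adjacentSwap-precedes : AdjacentSwap xs ys p q → Precedes x y xs → ¬ (x ≡ p × y ≡ q) → Precedes x y ys
  adjacentSwap-precedes here      (now (here refl)) x,y≢p,q = ⊥-elim (x,y≢p,q (refl , refl))
  adjacentSwap-precedes here      (now (there y∈))  _       = later (now y∈)
  adjacentSwap-precedes here      (later (now y∈))  _       = now (there y∈)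
  adjacentSwap-precedes here      (later (later b)) _       = later (later b)
  adjacentSwap-precedes (there s) (now y∈)          _       = now (adjacentSwap-∈ s y∈)
  adjacentSwap-precedes (there s) (later b)         x,y≢p,q = later (adjacentSwap-precedes s b x,y≢p,q)

module _ {A : Set} {P Q : A → Set} (P? : Decidable P) (Q? : Decidable Q) where

  length-filter-cong : ∀ {xs} → (∀ {x} → x ∈ xs → P x ⇔ Q x) →
                       length (filter P? xs) ≡ length (filter Q? xs)
  length-filter-cong {[]}     _   = refl
  length-filter-cong {x ∷ xs} P⇔Q with P? x | Q? x
  ... | yes _  | yes _  = cong suc (length-filter-cong (P⇔Q ∘ there))
  ... | no _   | no _   = length-filter-cong (P⇔Q ∘ there)
  ... | yes Px | no ¬Qx = ⊥-elim (¬Qx (to (P⇔Q (here refl)) Px))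
  ... | no ¬Px | yes Qx = ⊥-elim (¬Px (from (P⇔Q (here refl)) Qx))

  length-filter-extend : ∀ {xs z} → Unique xs → z ∈ xs → ¬ P z → (∀ x → Q x ⇔ (P x ⊎ x ≡ z)) →
                         length (filter Q? xs) ≡ suc (length (filter P? xs))
  length-filter-extend {x ∷ xs} (x∉ ∷ u) z∈ ¬Pz Q⇔ with z∈ | P? x | Q? x
  ... | here refl | yes Px | _      = ⊥-elim (¬Pz Px)
  ... | here refl | no _   | no ¬Qx = ⊥-elim (¬Qx (from (Q⇔ x) (inj₂ refl)))
  ... | here refl | no _   | yes _  = cong suc (sym (length-filter-cong P⇔Q))
    where
    P⇔Q : ∀ {y} → y ∈ xs → P y ⇔ Q y
    P⇔Q {y} y∈ = mk⇔ (from (Q⇔ y) ∘ inj₁) ([ id , ⊥-elim ∘ All.lookup x∉ y∈ ∘ sym ] ∘ to (Q⇔ y))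
  ... | there z∈′ | yes _  | yes _  = cong suc (length-filter-extend u z∈′ ¬Pz Q⇔)
  ... | there z∈′ | no _   | no _   = length-filter-extend u z∈′ ¬Pz Q⇔
  ... | there z∈′ | yes Px | no ¬Qx = ⊥-elim (¬Qx (from (Q⇔ x) (inj₁ Px)))
  ... | there z∈′ | no ¬Px | yes Qx = ⊥-elim ([ ¬Px , All.lookup x∉ z∈′ ] (to (Q⇔ x) Qx))

IsPermutation : ∀ {n} → Vec (Fin n) n → Set
IsPermutation {n} v = Uniqueᵥ v × (∀ (x : Fin n) → x ∈ᵥ v)

<[]⇔precedes : ∀ {n} {w : Vec (Fin n) n} {a b} → (a <[ w ] b) ⇔ Precedes a b w
<[]⇔precedes = mk⇔ (from precedes⇔positions) (to precedes⇔positions)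

isPermutation-id : ∀ n → IsPermutation (idPerm n)
isPermutation-id n = tabulate⁺ id , ∈-allFin⁺

isPermutation-swapAt : ∀ {n} {v : Vec (Fin n) n} k → IsPermutation v → IsPermutation (swapAt v k)
isPermutation-swapAt {v = v} k perm with swapAt-cases v k
... | inj₁ e rewrite e = perm
... | inj₂ (_ , _ , s) = adjacentSwap-unique s (proj₁ perm) , adjacentSwap-∈ s ∘ proj₂ perm

isPermutation-foldl : ∀ {n} {v : Vec (Fin n) n} is → IsPermutation v → IsPermutation (foldl _·s_ v is)
isPermutation-foldl []       perm = perm
isPermutation-foldl (i ∷ is) perm = isPermutation-foldl is (isPermutation-swapAt (i ∸ 1) perm)

Inversion : ∀ {n} → Vec (Fin n) n → Fin n × Fin n → Set
Inversion w (a , b) = a Fin.< b × b <[ w ] a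

keeps⇔¬inversion : ∀ {n} {v : Vec (Fin n) n} {x y} → IsPermutation v → x Fin.< y →
                   (x <[ v ] y) ⇔ (¬ Inversion v (x , y))
keeps⇔¬inversion {v = v} {x} {y} (unique , all∈) x<y = mk⇔
  (λ x≺y (_ , y≺x) → precedes-asym unique (to <[]⇔precedes x≺y) (to <[]⇔precedes y≺x))
  (λ ¬inv → keep ¬inv (precedes-total (Finₚ.<⇒≢ x<y) (all∈ _) (all∈ _)))
  where
  keep : ¬ Inversion v (x , y) → Precedes x y v ⊎ Precedes y x v → x <[ v ] y
  keep _    (inj₁ x≺y) = from <[]⇔precedes x≺y
  keep ¬inv (inj₂ y≺x) = contradiction (x<y , from <[]⇔precedes y≺x) ¬inv

infix 4 _⋖_
record _⋖_ {n} (v v′ : Vec (Fin n) n) : Set where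
  constructor cover
  field
    added      : Fin n × Fin n
    fresh      : ¬ Inversion v added
    inversions : ∀ π → Inversion v′ π ⇔ (Inversion v π ⊎ π ≡ added)

adjacentSwap-⋖ : ∀ {n} {v v′ : Vec (Fin n) n} {p q} →
                 Uniqueᵥ v → AdjacentSwap v v′ p q → p Fin.< q → v ⋖ v′
adjacentSwap-⋖ {v = v} {v′} {p} {q} u s p<q = cover (p , q) old new
  where
  p≺q : Precedes p q v
  p≺q = adjacentSwap-swapped (adjacentSwap-sym s)
  old : ¬ Inversion v (p , q)
  old (_ , q<p) = precedes-asym u p≺q (to <[]⇔precedes q<p)
  new : ∀ π′ → Inversion v′ π′ ⇔ (Inversion v π′ ⊎ π′ ≡ (p , q))
  new (x , y) = mk⇔ gain keep
    where
    gain : Inversion v′ (x , y) → Inversion v (x , y) ⊎ (x , y) ≡ (p , q)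
    gain (x<y , y≺x) with x Fin.≟ p | y Fin.≟ q
    ... | yes refl | yes refl = inj₂ refl
    ... | no x≢p | _ = inj₁ (x<y , from <[]⇔precedes
      (adjacentSwap-precedes (adjacentSwap-sym s) (to <[]⇔precedes y≺x) (x≢p ∘ proj₂)))
    ... | _ | no y≢q = inj₁ (x<y , from <[]⇔precedes
      (adjacentSwap-precedes (adjacentSwap-sym s) (to <[]⇔precedes y≺x) (y≢q ∘ proj₁)))
    keep : Inversion v (x , y) ⊎ (x , y) ≡ (p , q) → Inversion v′ (x , y)
    keep (inj₁ (x<y , y≺x)) = x<y , from <[]⇔precedes
      (adjacentSwap-precedes s (to <[]⇔precedes y≺x) λ { (refl , refl) → Finₚ.<-asym x<y p<q })
    keep (inj₂ refl) = p<q , from <[]⇔precedes (adjacentSwap-swapped s)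

⋖-mono : ∀ {n} {v v′ : Vec (Fin n) n} {π} → v ⋖ v′ → Inversion v π → Inversion v′ π
⋖-mono (cover _ _ inversions) inv = from (inversions _) (inj₁ inv)

⋖-added : ∀ {n} {v v′ : Vec (Fin n) n} {π π′} → v ⋖ v′ →
          ¬ Inversion v π → Inversion v′ π → ¬ Inversion v π′ → Inversion v′ π′ → π ≡ π′
⋖-added (cover _ _ inversions) ¬inv inv ¬inv′ inv′ with to (inversions _) inv | to (inversions _) inv′
... | inj₁ inv₀ | _         = contradiction inv₀ ¬inv
... | inj₂ _    | inj₁ inv₀ = contradiction inv₀ ¬inv′
... | inj₂ refl | inj₂ refl = refl

step-witness : ∀ {n} {v₀ v₁ : Vec (Fin n) n} {π π′} → v₀ ⋖ v₁ → π′ ≢ π →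
               ¬ Inversion v₀ π → Inversion v₁ π → Inversion v₁ π′ → Inversion v₀ π′
step-witness {v₀ = v₀} {π′ = π′} v₀⋖ π′≢π ¬inv inv inv′ with Inv-dec v₀ π′
... | yes inv₀′ = inv₀′
... | no ¬inv₀′ = contradiction (⋖-added v₀⋖ ¬inv₀′ inv′ ¬inv inv) π′≢π

pairs : ∀ n → List (Fin n × Fin n)
pairs n = List.cartesianProduct (List.allFin n) (List.allFin n)

invCount-⋖ : ∀ {n} {v v′ : Vec (Fin n) n} → v ⋖ v′ → invCount v′ ≡ suc (invCount v)
invCount-⋖ {n} {v} {v′} (cover π ¬inv inv⇔) =
  length-filter-extend (Inv-dec v) (Inv-dec v′) (cartesianProduct⁺ (allFin⁺ n) (allFin⁺ n))
    (∈-cartesianProduct⁺ (∈-allFin (proj₁ π)) (∈-allFin (proj₂ π))) ¬inv inv⇔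

idPerm-no-inversion : ∀ {n} π → ¬ Inversion (idPerm n) π
idPerm-no-inversion _ (a<b , i , j , i<j , bᵢ , aⱼ)
  rewrite lookup-allFin i | lookup-allFin j | bᵢ | aⱼ = Finₚ.<-asym a<b i<j

invCount-id : ∀ n → invCount (idPerm n) ≡ 0
invCount-id n =
  cong length (filter-none (Inv-dec (idPerm n)) {pairs n} (All.tabulate λ {π} _ → idPerm-no-inversion π))

⋖-or-invCount-≤ : ∀ {n} {v : Vec (Fin n) n} i → IsPermutation v →
                  v ⋖ v ·s i ⊎ invCount (v ·s i) ≤ invCount v
⋖-or-invCount-≤ {v = v} i perm with swapAt-cases v (i ∸ 1)
... | inj₁ e rewrite e = inj₂ ≤-refl
... | inj₂ (p , q , s) with <-cmp p q
...   | tri< p<q _ _ = inj₁ (adjacentSwap-⋖ (proj₁ perm) s p<q)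
...   | tri≈ _ p≡q _ = ⊥-elim (adjacentSwap-≢ (proj₁ perm) s p≡q)
...   | tri> _ _ q<p = inj₂ (≤-trans (n≤1+n _) (≤-reflexive (sym (invCount-⋖
          (adjacentSwap-⋖ (proj₁ (isPermutation-swapAt (i ∸ 1) perm)) (adjacentSwap-sym s) q<p)))))

data Ascending {n} : Vec (Fin n) n → List ℕ → Set where
  []  : ∀ {v} → Ascending v []
  _∷_ : ∀ {v i is} → v ⋖ v ·s i → Ascending (v ·s i) is → Ascending v (i ∷ is)

invCount-·s : ∀ {n} {v : Vec (Fin n) n} i → IsPermutation v → invCount (v ·s i) ≤ suc (invCount v)
invCount-·s i perm with ⋖-or-invCount-≤ i perm
... | inj₁ v⋖ = ≤-reflexive (invCount-⋖ v⋖)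
... | inj₂ ≤v = ≤-trans ≤v (n≤1+n _)

invCount-foldl : ∀ {n} {v : Vec (Fin n) n} is → IsPermutation v →
                 invCount (foldl _·s_ v is) ≤ invCount v + length is
invCount-foldl {v = v} []       _    = ≤-reflexive (sym (+-identityʳ (invCount v)))
invCount-foldl {v = v} (i ∷ is) perm = begin
  invCount (foldl _·s_ (v ·s i) is) ≤⟨ invCount-foldl is (isPermutation-swapAt (i ∸ 1) perm) ⟩
  invCount (v ·s i) + length is     ≤⟨ +-monoˡ-≤ (length is) (invCount-·s i perm) ⟩
  suc (invCount v) + length is      ≡⟨ sym (+-suc (invCount v) (length is)) ⟩
  invCount v + length (i ∷ is)      ∎
  where open ℕₚ.≤-Reasoning

invCount-grows⇒ascending : ∀ {n} {v : Vec (Fin n) n} is → IsPermutation v →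
                           invCount (foldl _·s_ v is) ≡ invCount v + length is → Ascending v is
invCount-grows⇒ascending []       _    _ = []
invCount-grows⇒ascending {v = v} (i ∷ is) perm full with ⋖-or-invCount-≤ i perm
... | inj₁ v⋖ = v⋖ ∷ invCount-grows⇒ascending is (isPermutation-swapAt (i ∸ 1) perm) (begin-equality
  invCount (foldl _·s_ (v ·s i) is) ≡⟨ full ⟩
  invCount v + suc (length is)      ≡⟨ +-suc (invCount v) (length is) ⟩
  suc (invCount v) + length is      ≡⟨ cong (_+ length is) (sym (invCount-⋖ v⋖)) ⟩
  invCount (v ·s i) + length is     ∎)
  where open ℕₚ.≤-Reasoning
... | inj₂ ≤v = ⊥-elim (ℕₚ.<-irrefl refl (begin-strict
  invCount (foldl _·s_ (v ·s i) is) ≤⟨ invCount-foldl is (isPermutation-swapAt (i ∸ 1) perm) ⟩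
  invCount (v ·s i) + length is     ≤⟨ +-monoˡ-≤ (length is) ≤v ⟩
  invCount v + length is            <⟨ ℕₚ.+-monoʳ-< (invCount v) (ℕₚ.n<1+n (length is)) ⟩
  invCount v + suc (length is)      ≡⟨ sym full ⟩
  invCount (foldl _·s_ (v ·s i) is) ∎))
  where open ℕₚ.≤-Reasoning

reduced⇒ascending : ∀ {n} {w : Vec (Fin n) n} {is} → ReducedWord w is → Ascending (idPerm n) is
reduced⇒ascending {n} {w} {is} (_ , evaluates , len) =
  invCount-grows⇒ascending is (isPermutation-id n) (begin
  invCount (eval n is)            ≡⟨ cong invCount evaluates ⟩
  invCount w                      ≡⟨ sym len ⟩
  length is                       ≡⟨ cong (_+ length is) (sym (invCount-id n)) ⟩
  invCount (idPerm n) + length is ∎)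
  where open ≡-Reasoning

-- 1 ≤ i, k matter because the letter i acts at position i ∸ 1.
·s-comm : ∀ {n} (v : Vec (Fin n) n) {i k} → 1 ≤ i → 1 ≤ k → FarApart i k → (v ·s i) ·s k ≡ (v ·s k) ·s i
·s-comm v {suc i} {suc k} _ _ (inj₁ i+2≤k) = swapAt-comm v i k (s≤s⁻¹ i+2≤k)
·s-comm v {suc i} {suc k} _ _ (inj₂ k+2≤i) = sym (swapAt-comm v k i (s≤s⁻¹ k+2≤i))

foldl-comm : ∀ {n} (v : Vec (Fin n) n) u r {i k} → 1 ≤ i → 1 ≤ k → FarApart i k →
             foldl _·s_ v (u ++ i ∷ k ∷ r) ≡ foldl _·s_ v (u ++ k ∷ i ∷ r)
foldl-comm v []      r 1≤i 1≤k far = cong (λ v′ → foldl _·s_ v′ r) (·s-comm v 1≤i 1≤k far)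
foldl-comm v (j ∷ u) r 1≤i 1≤k far = foldl-comm (v ·s j) u r 1≤i 1≤k far

commStep-reduced : ∀ {n} {w : Vec (Fin n) n} {j j′} → CommStep j j′ → ReducedWord w j → ReducedWord w j′
commStep-reduced (comm u r i k far) (valid , evaluates , len) with ++⁻ u valid
... | valid-u , (i-ok ∷ k-ok ∷ valid-r) =
  ++⁺ valid-u (k-ok ∷ i-ok ∷ valid-r) ,
  trans (sym (foldl-comm _ u r (proj₁ i-ok) (proj₁ k-ok) far)) evaluates ,
  trans (length-++ u) (trans (sym (length-++ u)) len)

class-reduced : ∀ {n} {w : Vec (Fin n) n} {j j′} → InCommClass j j′ → ReducedWord w j → ReducedWord w j′
class-reduced ε            rw = rw
class-reduced (step ◅ cls) rw = class-reduced cls (commStep-reduced step rw)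

ascending-++ : ∀ {n} {v : Vec (Fin n) n} p {r} → Ascending v (p ++ r) → Ascending (foldl _·s_ v p) r
ascending-++ []      asc       = asc
ascending-++ (_ ∷ p) (_ ∷ asc) = ascending-++ p asc

module _ {A B : Set} (f : A → B → A) where

  All-scanl-head : ∀ {P : A → Set} {a} xs → All P (scanl f a xs) → P a
  All-scanl-head _ (pa ∷ _) = pa

  All-scanl-++ : ∀ {P : A → Set} {a} xs {ys} → All P (scanl f a (xs ++ ys)) → All P (scanl f (foldl f a xs) ys)
  All-scanl-++ []       ps       = ps
  All-scanl-++ (x ∷ xs) (_ ∷ ps) = All-scanl-++ xs ps

  foldl-crossing : ∀ {P : A → Set} → Decidable P → ∀ {a} xs → ¬ P a → P (foldl f a xs) →
                   ∃[ ys ] ∃[ x ] ∃[ zs ] (xs ≡ ys ++ x ∷ zs × ¬ P (foldl f a ys) × P (f (foldl f a ys) x))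
  foldl-crossing P? []       ¬Pa Pa = contradiction Pa ¬Pa
  foldl-crossing P? {a} (x ∷ xs) ¬Pa Pend with P? (f a x)
  ... | yes Pfax = [] , x , xs , refl , ¬Pa , Pfax
  ... | no ¬Pfax with ys , y , zs , refl , ¬Pys , Pys ← foldl-crossing P? xs ¬Pfax Pend =
    x ∷ ys , y , zs , refl , ¬Pys , Pys

module _ {n} (X : Vec (Fin n) n → Set)
         (sandwich : ∀ {v₀ v₁ v₂} → IsPermutation v₁ → v₀ ⋖ v₁ → v₁ ⋖ v₂ → X v₀ → X v₂ → X v₁)
         where

  All-scanl-commStep : ∀ {v} u r {i k} → IsPermutation v → 1 ≤ i → 1 ≤ k → FarApart i k →
                       Ascending v (u ++ k ∷ i ∷ r) →
                       All X (scanl _·s_ v (u ++ i ∷ k ∷ r)) → All X (scanl _·s_ v (u ++ k ∷ i ∷ r))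
  All-scanl-commStep {v} [] r {i} {k} perm 1≤i 1≤k far (v⋖ ∷ v⋖′ ∷ _) (Xv ∷ _ ∷ Xs) =
    Xv ∷ sandwich (isPermutation-swapAt (k ∸ 1) perm) v⋖ v⋖′ Xv (All-scanl-head _·s_ r Xs′) ∷ Xs′
    where
    Xs′ : All X (scanl _·s_ ((v ·s k) ·s i) r)
    Xs′ = subst (λ v′ → All X (scanl _·s_ v′ r)) (·s-comm v 1≤i 1≤k far) Xs
  All-scanl-commStep (j ∷ u) r perm 1≤i 1≤k far (_ ∷ asc) (Xv ∷ Xs) =
    Xv ∷ All-scanl-commStep u r (isPermutation-swapAt (j ∸ 1) perm) 1≤i 1≤k far asc Xs

  All-scanl-class : ∀ {w : Vec (Fin n) n} {j j′} → ReducedWord w j → InCommClass j j′ →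
                    All X (scanl _·s_ (idPerm n) j) → All X (scanl _·s_ (idPerm n) j′)
  All-scanl-class rw ε Xs = Xs
  All-scanl-class {w} rw (comm u r i k far ◅ cls) Xs =
    All-scanl-class rw′ cls (All-scanl-commStep u r (isPermutation-id n) 1≤i 1≤k far (reduced⇒ascending rw′) Xs)
    where
    rw′ : ReducedWord w (u ++ k ∷ i ∷ r)
    rw′ = commStep-reduced (comm u r i k far) rw
    1≤k : 1 ≤ k
    1≤k = proj₁ (All.head (proj₂ (++⁻ u (proj₁ rw′))))
    1≤i : 1 ≤ i
    1≤i = proj₁ (All.head (All.tail (proj₂ (++⁻ u (proj₁ rw′)))))

module Domain {n} {w : Vec (Fin n) n} {𝐢} (rw : ReducedWord w 𝐢) where

  D : Vec (Fin n) n → Set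
  D = InPre n 𝐢

  D-id : D (idPerm n)
  D-id = 𝐢 , [] , 𝐢 , ε , refl , refl

  D-isPermutation : ∀ {u} → D u → IsPermutation u
  D-isPermutation (_ , p , _ , _ , _ , refl) = isPermutation-foldl p (isPermutation-id n)

  D-sandwich-closed : (X : Vec (Fin n) n → Set) →
    (∀ {v₀ v₁ v₂} → IsPermutation v₁ → v₀ ⋖ v₁ → v₁ ⋖ v₂ → X v₀ → X v₂ → X v₁) →
    All X (scanl _·s_ (idPerm n) 𝐢) → ∀ {u} → D u → X u
  D-sandwich-closed X sandwich Xs (j , p , q , cls , refl , refl) =
    All-scanl-head _·s_ q (All-scanl-++ _·s_ p (All-scanl-class X sandwich rw cls Xs))

  D-witness : ∀ {π π′} → π′ ≢ π → (∀ {u} → D u → Inversion u π → Inversion u π′) →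
              ∀ {u} → D u → Inversion u π → ∃[ u′ ] (D u′ × Inversion u′ π′ × ¬ Inversion u′ π)
  D-witness {π} {π′} π′≢π π⇒π′ (_ , p , q , cls , refl , refl) invπ
    with p₁ , i , p₂ , refl , ¬inv₀ , inv₁
           ← foldl-crossing _·s_ (λ v → Inv-dec v π) p (idPerm-no-inversion π) invπ =
    v₀ , D-v₀ , step-witness v₀⋖v₁ π′≢π ¬inv₀ inv₁ (π⇒π′ D-v₁ inv₁) , ¬inv₀
    where
    v₀ = foldl _·s_ (idPerm n) p₁
    split : (p₁ ++ i ∷ p₂) ++ q ≡ p₁ ++ i ∷ p₂ ++ q
    split = ++-assoc p₁ (i ∷ p₂) q
    D-v₀ : D v₀
    D-v₀ = _ , p₁ , i ∷ p₂ ++ q , cls , split , refl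
    D-v₁ : D (v₀ ·s i)
    D-v₁ = _ , p₁ ++ List.[ i ] , p₂ ++ q , cls , trans split (sym (++-assoc p₁ List.[ i ] (p₂ ++ q))) ,
           foldl-++ _·s_ (idPerm n) p₁ List.[ i ]
    v₀⋖v₁ : v₀ ⋖ v₀ ·s i
    v₀⋖v₁ with v₀⋖ ∷ _ ← ascending-++ p₁ (subst (Ascending (idPerm n)) split
                                              (reduced⇒ascending (class-reduced cls rw))) = v₀⋖

module Triple {n} {a b c : Fin n} (a<b : a Fin.< b) (b<c : b Fin.< c) where

  ab ac bc : Fin n × Fin n
  ab = a , b
  ac = a , c
  bc = b , c

  -- abFirst is the chain abc < bac < bca < cba, bcFirst the chain abc < acb < cab < cba
  data Side : Set where
    abFirst bcFirst : Side

  first last : Side → Fin n × Fin n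
  first abFirst = ab
  first bcFirst = bc
  last  abFirst = bc
  last  bcFirst = ab

  OnSide : Side → Vec (Fin n) n → Set
  OnSide t v = (Inversion v (last t) → Inversion v ac) × (Inversion v ac → Inversion v (first t))

  private
    a<c : a Fin.< c
    a<c = Finₚ.<-trans a<b b<c

    a≢b : a ≢ b
    a≢b a≡b = Finₚ.<-irrefl a≡b a<b

    b≢c : b ≢ c
    b≢c b≡c = Finₚ.<-irrefl b≡c b<c

  ac≢first : ∀ t → ac ≢ first t
  ac≢first abFirst = b≢c ∘ sym ∘ cong proj₂
  ac≢first bcFirst = a≢b ∘ cong proj₁

  ac≢last : ∀ t → ac ≢ last t
  ac≢last abFirst = a≢b ∘ cong proj₁
  ac≢last bcFirst = b≢c ∘ sym ∘ cong proj₂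

  private
    precedes : ∀ {v : Vec (Fin n) n} {x y} → y <[ v ] x → Precedes y x v
    precedes = to <[]⇔precedes

    <[] : ∀ {v : Vec (Fin n) n} {x y} → Precedes y x v → y <[ v ] x
    <[] = from <[]⇔precedes

  ab×bc⇒ac : ∀ {v} → IsPermutation v → Inversion v ab → Inversion v bc → Inversion v ac
  ab×bc⇒ac (unique , _) (_ , b≺a) (_ , c≺b) = a<c , <[] (precedes-trans unique (precedes c≺b) (precedes b≺a))

  ac⇒ab⊎bc : ∀ {v} → IsPermutation v → Inversion v ac → Inversion v ab ⊎ Inversion v bc
  ac⇒ab⊎bc (unique , all∈) (_ , c≺a) with precedes-total a≢b (all∈ a) (all∈ b)
  ... | inj₁ a≺b = inj₂ (b<c , <[] (precedes-trans unique (precedes c≺a) a≺b))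
  ... | inj₂ b≺a = inj₁ (a<b , <[] b≺a)

  onSide-first : ∀ {v} t → IsPermutation v → Inversion v (first t) → OnSide t v
  onSide-first abFirst perm inv-ab = (λ inv-bc → ab×bc⇒ac perm inv-ab inv-bc) , λ _ → inv-ab
  onSide-first bcFirst perm inv-bc = (λ inv-ab → ab×bc⇒ac perm inv-ab inv-bc) , λ _ → inv-bc

  ac⇒first⊎last : ∀ {v} t → IsPermutation v → Inversion v ac → Inversion v (first t) ⊎ Inversion v (last t)
  ac⇒first⊎last abFirst perm inv = ac⇒ab⊎bc perm inv
  ac⇒first⊎last bcFirst perm inv with ac⇒ab⊎bc perm inv
  ... | inj₁ inv-ab = inj₂ inv-ab
  ... | inj₂ inv-bc = inj₁ inv-bc

  onSide-empty : ∀ {v} t → IsPermutation v → ¬ Inversion v ab → ¬ Inversion v bc → OnSide t v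
  onSide-empty abFirst perm ¬ab ¬bc = ⊥-elim ∘ ¬bc , ⊥-elim ∘ [ ¬ab , ¬bc ] ∘ ac⇒ab⊎bc perm
  onSide-empty bcFirst perm ¬ab ¬bc = ⊥-elim ∘ ¬ab , ⊥-elim ∘ [ ¬ab , ¬bc ] ∘ ac⇒ab⊎bc perm

  onSide-ascending : ∀ {v is} t → IsPermutation v → Ascending v is → Inversion v (first t) →
                     All (OnSide t) (scanl _·s_ v is)
  onSide-ascending t perm []                   inv = onSide-first t perm inv ∷ []
  onSide-ascending {is = i ∷ _} t perm (v⋖ ∷ asc) inv =
    onSide-first t perm inv ∷ onSide-ascending t (isPermutation-swapAt (i ∸ 1) perm) asc (⋖-mono v⋖ inv)

  -- The chain is fixed by whichever of ab, bc the word inverts first.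
  side-of-ascending : ∀ {v is} → IsPermutation v → Ascending v is → ¬ Inversion v ab → ¬ Inversion v bc →
                      ∃[ t ] All (OnSide t) (scanl _·s_ v is)
  side-of-ascending perm [] ¬ab ¬bc = abFirst , onSide-empty abFirst perm ¬ab ¬bc ∷ []
  side-of-ascending {v} {i ∷ _} perm (_ ∷ asc) ¬ab ¬bc
    with perm′ ← isPermutation-swapAt (i ∸ 1) perm | Inv-dec (v ·s i) ab | Inv-dec (v ·s i) bc
  ... | yes inv-ab | _ =
    abFirst , onSide-empty abFirst perm ¬ab ¬bc ∷ onSide-ascending abFirst perm′ asc inv-ab
  ... | no _ | yes inv-bc =
    bcFirst , onSide-empty bcFirst perm ¬ab ¬bc ∷ onSide-ascending bcFirst perm′ asc inv-bc
  ... | no ¬ab′ | no ¬bc′ with t , sides ← side-of-ascending perm′ asc ¬ab′ ¬bc′ =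
    t , onSide-empty t perm ¬ab ¬bc ∷ sides

  onSide-sandwich : ∀ {t v₀ v₁ v₂} → IsPermutation v₁ → v₀ ⋖ v₁ → v₁ ⋖ v₂ →
                    OnSide t v₀ → OnSide t v₂ → OnSide t v₁
  onSide-sandwich {t} {v₀} {v₁} {v₂} perm v₀⋖ v₁⋖ side₀ side₂ with Inv-dec v₁ (first t)
  ... | yes first₁ = onSide-first t perm first₁
  ... | no ¬first₁ = ⊥-elim ∘ ¬last₁ , ⊥-elim ∘ ¬ac₁
    where
    ¬ac₀ : ¬ Inversion v₀ ac
    ¬ac₀ = ¬first₁ ∘ ⋖-mono v₀⋖ ∘ proj₂ side₀
    ¬ac₁ : ¬ Inversion v₁ ac
    ¬ac₁ ac₁ with ac⇒first⊎last t perm ac₁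
    ... | inj₁ first₁ = ¬first₁ first₁
    ... | inj₂ last₁  = ac≢last t (⋖-added v₀⋖ ¬ac₀ ac₁ (¬ac₀ ∘ proj₁ side₀) last₁)
    ¬last₁ : ¬ Inversion v₁ (last t)
    ¬last₁ last₁ = ac≢first t (⋖-added v₁⋖ ¬ac₁ ac₂ ¬first₁ (proj₂ side₂ ac₂))
      where ac₂ = proj₁ side₂ (⋖-mono v₁⋖ last₁)

  module _ {w : Vec (Fin n) n} {𝐢} (rw : ReducedWord w 𝐢) where
    open Domain rw

    D-side : ∃[ t ] (∀ {u} → D u → OnSide t u)
    D-side with t , sides ← side-of-ascending (isPermutation-id n) (reduced⇒ascending rw)
                              (idPerm-no-inversion ab) (idPerm-no-inversion bc) =
      t , D-sandwich-closed (OnSide t) (onSide-sandwich {t}) sides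

module _ {A : Set} (f : A → ℕ) where

  module _ {P Q : A → Set} (P? : Decidable P) (Q? : Decidable Q) where

    sum-filter-mono : ∀ xs → (∀ {x} → x ∈ xs → 0 < f x → P x → Q x) →
                      sum (map f (filter P? xs)) ≤ sum (map f (filter Q? xs))
    sum-filter-mono []       _ = z≤n
    sum-filter-mono (x ∷ xs) P⇒Q with P? x | Q? x | sum-filter-mono xs (P⇒Q ∘ there)
    ... | yes _  | yes _  | ih = +-monoʳ-≤ (f x) ih
    ... | no _   | no _   | ih = ih
    ... | no _   | yes _  | ih = ≤-trans ih (m≤n+m _ (f x))
    ... | yes Px | no ¬Qx | ih = ≤-trans (+-monoˡ-≤ _ (≮⇒≥ λ pos → ¬Qx (P⇒Q (here refl) pos Px))) ih

    sum-filter-strict : ∀ xs → (∀ {x} → x ∈ xs → 0 < f x → P x → Q x) →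
                        ∀ {z} → z ∈ xs → 0 < f z → ¬ P z → Q z →
                        sum (map f (filter P? xs)) < sum (map f (filter Q? xs))
    sum-filter-strict (x ∷ xs) P⇒Q (here refl) pos ¬Pz Qz with P? x | Q? x
    ... | yes Pz | _      = contradiction Pz ¬Pz
    ... | no _   | no ¬Qz = contradiction Qz ¬Qz
    ... | no _   | yes _  = ≤-<-trans (sum-filter-mono xs (P⇒Q ∘ there)) (m<n+m _ pos)
    sum-filter-strict (x ∷ xs) P⇒Q (there z∈) pos ¬Pz Qz
      with P? x | Q? x | sum-filter-strict xs (P⇒Q ∘ there) z∈ pos ¬Pz Qz
    ... | yes _  | yes _  | ih = ℕₚ.+-monoʳ-< (f x) ih
    ... | no _   | no _   | ih = ih
    ... | no _   | yes _  | ih = ℕₚ.<-≤-trans ih (m≤n+m _ (f x))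
    ... | yes Px | no ¬Qx | ih = ≤-<-trans (+-monoˡ-≤ _ (≮⇒≥ λ pos → ¬Qx (P⇒Q (here refl) pos Px))) ih

  module _ {P : A → Set} (P? : Decidable P) where

    sum-filter-pos : ∀ xs → 0 < sum (map f (filter P? xs)) → ∃[ x ] (x ∈ xs × P x × 0 < f x)
    sum-filter-pos (x ∷ xs) pos with P? x
    ... | no _ with y , y∈ , Py , fy>0 ← sum-filter-pos xs pos = y , there y∈ , Py , fy>0
    ... | yes Px with f x in fx≡
    ...   | suc _ = x , here refl , Px , ℕₚ.<-≤-trans (s≤s z≤n) (ℕₚ.≤-reflexive (sym fx≡))
    ...   | zero with y , y∈ , Py , fy>0 ← sum-filter-pos xs pos = y , there y∈ , Py , fy>0

    sum-filter-≥ : ∀ xs {z} → z ∈ xs → P z → f z ≤ sum (map f (filter P? xs))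
    sum-filter-≥ (x ∷ xs) (here refl) Pz with P? x
    ... | yes _   = m≤m+n (f x) _
    ... | no ¬Pz  = contradiction Pz ¬Pz
    sum-filter-≥ (x ∷ xs) (there z∈) Pz with P? x
    ... | yes _ = ≤-trans (sum-filter-≥ xs z∈ Pz) (m≤n+m _ (f x))
    ... | no _  = sum-filter-≥ xs z∈ Pz

isPermutation⇒isPermᵇ : ∀ {n} {v : Vec (Fin n) n} → IsPermutation v → T (isPermᵇ v)
isPermutation⇒isPermᵇ {n} {v} (_ , all∈) = all⁻ _ {List.allFin n} (All.tabulate λ {i} _ →
  any⁺ (λ j → ⌊ i Fin.≟ j ⌋) (Any.map fromWitness (∈-toList⁺ (all∈ i))))

allVecs-complete : ∀ {n} k (v : Vec (Fin n) k) → v ∈ allVecs k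
allVecs-complete zero    []       = here refl
allVecs-complete {n} (suc k) (x ∷ v) =
  ∈-concatMap⁺ (λ x′ → map (x′ Vec.∷_) (allVecs k))
    (Any.map (λ { refl → ∈-map⁺ (x Vec.∷_) (allVecs-complete k v) }) (∈-allFin x))

keepPerms-complete : ∀ {n} (u : S n) vs → proj₁ u ∈ vs → u ∈ keepPerms vs
keepPerms-complete (v , p) (v′ ∷ vs) (here refl) with T? (isPermᵇ v′)
... | yes p′ = here (cong (v ,_) (T-irrelevant p p′))
... | no ¬p  = contradiction p ¬p
keepPerms-complete u (v′ ∷ vs) (there u∈) with T? (isPermᵇ v′)
... | yes _ = there (keepPerms-complete u vs u∈)
... | no _  = keepPerms-complete u vs u∈

allPerms-complete : ∀ {n} (u : S n) → u ∈ allPerms n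
allPerms-complete {n} u = keepPerms-complete u (allVecs n) (allVecs-complete n (proj₁ u))

module Tally {n} (ρ : VoteTally n) {w : Vec (Fin n) n} {𝐢} (rw : ReducedWord w 𝐢)
             (support : ∀ (u : S n) → (ρ u > 0) ⇔ InPre n 𝐢 (proj₁ u)) where
  open Domain rw

  private
    voter : ∀ {v} → D v → S n
    voter {v} d = v , isPermutation⇒isPermᵇ (D-isPermutation d)

  votes-mono : ∀ {x y x′ y′} → (∀ {v} → D v → x <[ v ] y → x′ <[ v ] y′) → votes ρ x y ≤ votes ρ x′ y′
  votes-mono h = sum-filter-mono ρ _ _ (allPerms n) (λ {u} _ pos → h (to (support u) pos))

  votes-strict : ∀ {x y x′ y′} → (∀ {v} → D v → x <[ v ] y → x′ <[ v ] y′) →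
                 ∀ {v} → D v → ¬ x <[ v ] y → x′ <[ v ] y′ → votes ρ x y < votes ρ x′ y′
  votes-strict h d ¬xy x′y′ = sum-filter-strict ρ _ _ (allPerms n) (λ {u} _ pos → h (to (support u) pos))
    (allPerms-complete (voter d)) (from (support (voter d)) d) ¬xy x′y′

  votes-pos : ∀ {x y} → 0 < votes ρ x y → ∃[ v ] (D v × x <[ v ] y)
  votes-pos pos with u , _ , x≺y , ρu>0 ← sum-filter-pos ρ _ (allPerms n) pos =
    proj₁ u , to (support u) ρu>0 , x≺y

  votes-pos-id : ∀ {x y} → x Fin.< y → 0 < votes ρ x y
  votes-pos-id {x} {y} x<y = ℕₚ.<-≤-trans (from (support (voter D-id)) D-id)
    (sum-filter-≥ ρ _ (allPerms n) (allPerms-complete (voter D-id))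
       (x , y , x<y , lookup-allFin x , lookup-allFin y))

MajorityOf : ∀ {A : Set} → (A → A → ℕ) → A → A → Set
MajorityOf V x y = V y x < V x y

Tie : ∀ {A : Set} → (A → A → Set) → A → A → Set
Tie R x y = ¬ R x y × ¬ R y x

-- (g , n) and (g′ , n′) count the voters inverting and keeping two consecutive pairs of a chain
record Shrinks (g n g′ n′ : ℕ) : Set where
  field
    inverters-≤ : g′ ≤ g
    keepers-≤   : n ≤ n′
    strict      : 0 < g′ → g′ < g × n < n′

module _ {g n g′ n′ : ℕ} (s : Shrinks g n g′ n′) where
  open Shrinks s

  shrinks-keep : g < n → g′ < n′
  shrinks-keep g<n = ≤-<-trans inverters-≤ (<-≤-trans g<n keepers-≤)

  shrinks-invert : n′ < g′ → n < g
  shrinks-invert n′<g′ = ≤-<-trans keepers-≤ (<-≤-trans n′<g′ inverters-≤)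

  private
    tied : ∀ {x y} → ¬ x < y → ¬ y < x → x ≡ y
    tied x≮y y≮x = ≤-antisym (≮⇒≥ y≮x) (≮⇒≥ x≮y)

  shrinks-tie-keep : 0 < n → ¬ g < n → ¬ n < g → g′ < n′
  shrinks-tie-keep 0<n g≮n n≮g with 0 <? g′
  ... | yes 0<g′ = <-≤-trans (proj₁ (strict 0<g′)) (subst (_≤ n′) (sym (tied g≮n n≮g)) keepers-≤)
  ... | no 0≮g′  = ≤-<-trans (≮⇒≥ 0≮g′) (≤-trans 0<n keepers-≤)

  shrinks-tie-invert : 0 < n → ¬ g′ < n′ → ¬ n′ < g′ → n < g
  shrinks-tie-invert 0<n g′≮n′ n′≮g′ = ≤-<-trans keepers-≤ (subst (_< g) g′≡n′ (proj₁ (strict 0<g′)))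
    where
    g′≡n′ : g′ ≡ n′
    g′≡n′ = tied g′≮n′ n′≮g′
    0<g′ : 0 < g′
    0<g′ = <-≤-trans 0<n (subst (n ≤_) (sym g′≡n′) keepers-≤)

data Arrangement {A : Set} (p q r : A) : A → A → A → Set where
  pqr : Arrangement p q r p q r
  prq : Arrangement p q r p r q
  qpr : Arrangement p q r q p r
  qrp : Arrangement p q r q r p
  rpq : Arrangement p q r r p q
  rqp : Arrangement p q r r q p

arrangement-reverse : ∀ {A : Set} {p q r x y z : A} → Arrangement p q r x y z → Arrangement r q p y x z
arrangement-reverse pqr = qrp
arrangement-reverse prq = prq
arrangement-reverse qpr = rqp
arrangement-reverse qrp = pqr
arrangement-reverse rpq = rpq
arrangement-reverse rqp = qpr

-- the majority of V on a triple whose pairs pq, pr, qr are inverted by shrinking electorates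
module ChainMajority {A : Set} (V : A → A → ℕ) {p q r : A}
                     (pq⇝pr : Shrinks (V q p) (V p q) (V r p) (V p r))
                     (pr⇝qr : Shrinks (V r p) (V p r) (V r q) (V q r))
                     (0<keep : 0 < V p q) where

  private
    R = MajorityOf V

    0<keep′ : 0 < V p r
    0<keep′ = ≤-trans 0<keep (Shrinks.keepers-≤ pq⇝pr)

  negTrans : ∀ {x y z} → Arrangement p q r x y z → R x y → R x z ⊎ R z y
  negTrans pqr Rpq = inj₁ (shrinks-keep pq⇝pr Rpq)
  negTrans prq Rpr = inj₂ (shrinks-keep pr⇝qr Rpr)
  negTrans rpq Rrp = inj₂ (shrinks-invert pq⇝pr Rrp)
  negTrans rqp Rrq = inj₁ (shrinks-invert pr⇝qr Rrq)
  negTrans qpr _ with V p r <? V r p | V r p <? V p r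
  ... | yes Rrp | _      = inj₂ Rrp
  ... | no _    | yes Rpr = inj₁ (shrinks-keep pr⇝qr Rpr)
  ... | no ¬Rrp | no ¬Rpr = inj₁ (shrinks-tie-keep pr⇝qr 0<keep′ ¬Rpr ¬Rrp)
  negTrans qrp _ with V r p <? V p r | V p r <? V r p
  ... | yes Rpr | _      = inj₂ Rpr
  ... | no _    | yes Rrp = inj₁ (shrinks-invert pq⇝pr Rrp)
  ... | no ¬Rpr | no ¬Rrp = inj₁ (shrinks-tie-invert pq⇝pr 0<keep ¬Rpr ¬Rrp)

  noTwoTies : Tie R p q → Tie R q r → ⊥
  noTwoTies (¬Rpq , ¬Rqp) (¬Rqr , ¬Rrq) =
    <-asym (shrinks-tie-keep pq⇝pr 0<keep ¬Rpq ¬Rqp) (shrinks-tie-invert pr⇝qr 0<keep′ ¬Rqr ¬Rrq)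

module _ {A : Set} (key : A → ℕ) where

  level : List A → ℕ → List A
  level xs k = filter (λ x → key x ℕ.≟ k) xs

  private
    levels : List ℕ → List A → List A
    levels ks xs = concat (map (level xs) ks)

    level-accept : ∀ {x} xs {k} → key x ≡ k → level (x ∷ xs) k ≡ x ∷ level xs k
    level-accept xs {k} = filter-accept (λ x → key x ℕ.≟ k)

    level-reject : ∀ {x} xs {k} → key x ≢ k → level (x ∷ xs) k ≡ level xs k
    level-reject xs {k} = filter-reject (λ x → key x ℕ.≟ k)

    levels-skip : ∀ ks {x} xs → key x ∉ ks → levels ks (x ∷ xs) ≡ levels ks xs
    levels-skip []       xs _  = refl
    levels-skip (k ∷ ks) xs x∉ =
      cong₂ _++_ (level-reject xs (x∉ ∘ here)) (levels-skip ks xs (x∉ ∘ there))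

    levels-cons : ∀ ks {x} xs → Unique ks → key x ∈ ks → levels ks (x ∷ xs) ↭ x ∷ levels ks xs
    levels-cons (k ∷ ks) {x} xs (k∉ ∷ u) (here refl) = ↭-reflexive (cong₂ _++_ (level-accept xs refl)
      (levels-skip ks xs λ x∈ks → All.lookup k∉ x∈ks refl))
    levels-cons (k ∷ ks) {x} xs (k∉ ∷ u) (there x∈ks) with key x ℕ.≟ k
    ... | yes refl = contradiction refl (All.lookup k∉ x∈ks)
    ... | no kx≢k  = ↭-trans (↭-reflexive (cong (_++ levels ks (x ∷ xs)) (level-reject xs kx≢k)))
      (↭-trans (++⁺ˡ (level xs k) (levels-cons ks xs u x∈ks)) (shift x (level xs k) _))

  levels-↭ : ∀ ks xs → Unique ks → (∀ {x} → x ∈ xs → key x ∈ ks) → concat (map (level xs) ks) ↭ xs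
  levels-↭ ks []       _ _    = ↭-reflexive (nil ks)
    where nil : ∀ ks → levels ks [] ≡ []
          nil []       = refl
          nil (_ ∷ ks) = nil ks
  levels-↭ ks (x ∷ xs) u keys =
    ↭-trans (levels-cons ks xs u (keys (here refl))) (prep x (levels-↭ ks xs u (keys ∘ there)))

AllPairs-lookup : ∀ {A : Set} {R : A → A → Set} {xs} → AllPairs R xs →
                  ∀ {i j} → i Fin.< j → R (List.lookup xs i) (List.lookup xs j)
AllPairs-lookup (Rx ∷ _)  {Fin.zero}  {Fin.suc j} _         = All.lookup Rx (∈-lookup j)
AllPairs-lookup (_ ∷ Rxs) {Fin.suc i} {Fin.suc j} (s≤s i<j) = AllPairs-lookup Rxs i<j

nonEmpty? : ∀ {A : Set} (B : List A) → Dec (¬ B ≡ [])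
nonEmpty? []      = no λ ¬[] → ¬[] refl
nonEmpty? (_ ∷ _) = yes λ ()

concat-nonEmpty : ∀ {A : Set} (Bs : List (List A)) → concat (filter nonEmpty? Bs) ≡ concat Bs
concat-nonEmpty []             = refl
concat-nonEmpty ([] ∷ Bs)      = concat-nonEmpty Bs
concat-nonEmpty ((x ∷ B) ∷ Bs) = cong ((x ∷ B) ++_) (concat-nonEmpty Bs)

module KeyPartition {n} (key : Fin n → ℕ) (m : ℕ) (key< : ∀ x → key x < m) where

  private
    levelSets : List (List (Fin n))
    levelSets = map (level key (List.allFin n)) (upTo m)

  keyBlocks : List (List (Fin n))
  keyBlocks = filter nonEmpty? levelSets

  keyPartition : OrderedSetPartition n
  keyPartition = record
    { blocks   = keyBlocks
    ; nonempty = all-filter nonEmpty? levelSets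
    ; covers   = ↭-trans (↭-reflexive (concat-nonEmpty levelSets))
                   (levels-↭ key (upTo m) (List.allFin n) (upTo⁺ m) λ {x} _ → ∈-upTo⁺ (key< x))
    }

  keyBlocks-levels : All (λ B → ∃[ k ] B ≡ level key (List.allFin n) k) keyBlocks
  keyBlocks-levels = Allₚ.filter⁺ nonEmpty? (Allₚ.map⁺ (All.universal (λ k → k , refl) (upTo m)))

  private
    level-key : ∀ {x k} → x ∈ level key (List.allFin n) k → key x ≡ k
    level-key {k = k} = proj₂ ∘ ∈-filter⁻ (λ y → key y ℕ.≟ k) {xs = List.allFin n}

    Below : List (Fin n) → List (Fin n) → Set
    Below B B′ = ∀ {x y} → x ∈ B → y ∈ B′ → key x < key y

    keyBlocks-sorted : AllPairs Below keyBlocks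
    keyBlocks-sorted = AllPairsₚ.filter⁺ nonEmpty? (AllPairsₚ.map⁺ (AllPairs.map
      (λ k<k′ {_} {_} x∈ y∈ → subst₂ _<_ (sym (level-key x∈)) (sym (level-key y∈)) k<k′)
      (applyUpTo⁺₁ (λ k → k) m λ k<k′ _ → k<k′)))

    block-key : ∀ {r x y} → x ∈ List.lookup keyBlocks r → y ∈ List.lookup keyBlocks r → key x ≡ key y
    block-key {r} x∈ y∈ with k , B≡ ← All.lookup keyBlocks-levels (∈-lookup r) rewrite B≡ =
      trans (level-key x∈) (sym (level-key y∈))

    block-of : ∀ x → ∃[ r ] x ∈ List.lookup keyBlocks r
    block-of x = Any.index x∈ , lookup-index x∈
      where x∈ = ∈-concat⁻ keyBlocks (∈-resp-↭ (↭-sym (covers keyPartition)) (∈-allFin x))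

  induced⇔key< : ∀ x y → Induced keyPartition x y ⇔ key x < key y
  induced⇔key< x y = mk⇔ (λ (r , s , r<s , x∈ , y∈) → AllPairs-lookup keyBlocks-sorted r<s x∈ y∈) sorted
    where
    sorted : key x < key y → Induced keyPartition x y
    sorted kx<ky with block-of x | block-of y
    ... | r , x∈ | s , y∈ with <-cmp r s
    ...   | tri< r<s _ _ = r , s , r<s , x∈ , y∈
    ...   | tri≈ _ refl _ = contradiction (block-key x∈ y∈) (ℕₚ.<⇒≢ kx<ky)
    ...   | tri> _ _ s<r = contradiction (AllPairs-lookup keyBlocks-sorted s<r y∈ x∈) (ℕₚ.<⇒≯ kx<ky)

length≡sum-ones : ∀ {A : Set} (xs : List A) → length xs ≡ sum (map (λ _ → 1) xs)
length≡sum-ones []       = refl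
length≡sum-ones (_ ∷ xs) = cong suc (length≡sum-ones xs)

module _ {n} {R : Fin n → Fin n → Set} (R? : ∀ x y → Dec (R x y))
         (asym : ∀ {x y} → R x y → ¬ R y x)
         (negTrans : ∀ {x y} z → R x y → R x z ⊎ R z y)
         (noTwoTies : ∀ {x y z} → x Fin.< y → y Fin.< z → Tie R x y → Tie R y z → ⊥) where

  private
    above : Fin n → List (Fin n)
    above x = filter (λ y → R? y x) (List.allFin n)

    rank : Fin n → ℕ
    rank x = length (above x)

    rank< : ∀ x → rank x < suc n
    rank< x = s≤s (≤-trans (length-filter (λ y → R? y x) (List.allFin n))
                           (≤-reflexive (length-tabulate (λ y → y))))

    R-trans : ∀ {x y z} → R x y → R y z → R x z
    R-trans Rxy Ryz with negTrans _ Rxy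
    ... | inj₁ Rxz = Rxz
    ... | inj₂ Rzy = contradiction Rzy (asym Ryz)

    R⇒rank< : ∀ {x y} → R x y → rank x < rank y
    R⇒rank< {x} {y} Rxy = subst₂ _<_ (sym (length≡sum-ones (above x))) (sym (length≡sum-ones (above y)))
      (sum-filter-strict (λ _ → 1) (λ z → R? z x) (λ z → R? z y) (List.allFin n) (λ _ _ Rzx → R-trans Rzx Rxy)
        (∈-allFin x) (s≤s z≤n) (λ Rxx → asym Rxx Rxx) Rxy)

    ¬R⇒rank≤ : ∀ {x y} → ¬ R x y → rank y ≤ rank x
    ¬R⇒rank≤ {x} {y} ¬Rxy = subst₂ _≤_ (sym (length≡sum-ones (above y))) (sym (length≡sum-ones (above x)))
      (sum-filter-mono (λ _ → 1) (λ z → R? z y) (λ z → R? z x) (List.allFin n) λ _ _ Rzy →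
        [ (λ Rzx → Rzx) , (λ Rxy → contradiction Rxy ¬Rxy) ] (negTrans x Rzy))

    R⇔rank< : ∀ x y → R x y ⇔ rank x < rank y
    R⇔rank< x y = mk⇔ R⇒rank< λ rx<ry → decidable-stable (R? x y)
      (λ ¬Rxy → ℕₚ.<⇒≱ rx<ry (¬R⇒rank≤ ¬Rxy))

    equal-rank⇒tie : ∀ {x y} → rank x ≡ rank y → Tie R x y
    equal-rank⇒tie rx≡ry = (λ Rxy → <-irrefl rx≡ry (R⇒rank< Rxy)) ,
                           (λ Ryx → <-irrefl (sym rx≡ry) (R⇒rank< Ryx))

    block-size : ∀ B → AllPairs Fin._<_ B → (∀ {x y} → x ∈ B → y ∈ B → rank x ≡ rank y) → length B ≤ 2
    block-size []              _ _ = z≤n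
    block-size (_ ∷ [])        _ _ = s≤s z≤n
    block-size (_ ∷ _ ∷ [])    _ _ = s≤s (s≤s z≤n)
    block-size (x ∷ y ∷ z ∷ B) ((x<y ∷ _) ∷ (y<z ∷ _) ∷ _) same = ⊥-elim (noTwoTies x<y y<z
      (equal-rank⇒tie (same (here refl) (there (here refl))))
      (equal-rank⇒tie (same (there (here refl)) (there (there (here refl))))))

    open KeyPartition rank (suc n) rank<

    level-size : ∀ k → length (level rank (List.allFin n) k) ≤ 2
    level-size k = block-size _ (AllPairsₚ.filter⁺ _ (tabulate⁺-< (λ i<j → i<j)))
      λ x∈ y∈ → trans (level-rank x∈) (sym (level-rank y∈))
      where
      level-rank : ∀ {x} → x ∈ level rank (List.allFin n) k → rank x ≡ k
      level-rank = proj₂ ∘ ∈-filter⁻ (λ y → rank y ℕ.≟ k) {xs = List.allFin n}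

  strictWeakOrder⇒prelinearSimpleTies : IsPrelinearSimpleTies R
  strictWeakOrder⇒prelinearSimpleTies =
    keyPartition ,
    (λ x y → mk⇔ (from (induced⇔key< x y) ∘ to (R⇔rank< x y))
                 (from (R⇔rank< x y) ∘ to (induced⇔key< x y))) ,
    All.map (λ { (k , refl) → level-size k }) keyBlocks-levels

module TilingMajority {n} (ρ : VoteTally n) {w : Vec (Fin n) n} {𝐢} (rw : ReducedWord w 𝐢)
                      (support : ∀ (u : S n) → (ρ u > 0) ⇔ InPre n 𝐢 (proj₁ u)) where
  open Domain rw
  open Tally ρ rw support

  inverting keeping : Fin n × Fin n → ℕ
  inverting (x , y) = votes ρ y x
  keeping   (x , y) = votes ρ x y

  pair-shrinks : ∀ {x y x′ y′} → x Fin.< y → x′ Fin.< y′ → (x′ , y′) ≢ (x , y) →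
                 (∀ {u} → D u → Inversion u (x′ , y′) → Inversion u (x , y)) →
                 Shrinks (inverting (x , y)) (keeping (x , y)) (inverting (x′ , y′)) (keeping (x′ , y′))
  pair-shrinks {x} {y} {x′} {y′} x<y x′<y′ π′≢π π′⇒π = record
    { inverters-≤ = votes-mono inverts
    ; keepers-≤   = votes-mono keeps
    ; strict      = strict
    }
    where
    inverts : ∀ {u} → D u → y′ <[ u ] x′ → y <[ u ] x
    inverts d y′≺x′ = proj₂ (π′⇒π d (x′<y′ , y′≺x′))
    keeps : ∀ {u} → D u → x <[ u ] y → x′ <[ u ] y′
    keeps d = from (keeps⇔¬inversion (D-isPermutation d) x′<y′)
            ∘ (λ ¬inv inv′ → ¬inv (π′⇒π d inv′)) ∘ to (keeps⇔¬inversion (D-isPermutation d) x<y)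
    strict : 0 < inverting (x′ , y′) →
             inverting (x′ , y′) < inverting (x , y) × keeping (x , y) < keeping (x′ , y′)
    strict pos with u , d , y′≺x′ ← votes-pos pos
               with u′ , d′ , inv , ¬inv′ ← D-witness (π′≢π ∘ sym) π′⇒π d (x′<y′ , y′≺x′) =
      votes-strict inverts d′ (λ y′≺x′ → ¬inv′ (x′<y′ , y′≺x′)) (proj₂ inv) ,
      votes-strict keeps d′ (λ x≺y → to (keeps⇔¬inversion (D-isPermutation d′) x<y) x≺y inv)
                            (from (keeps⇔¬inversion (D-isPermutation d′) x′<y′) ¬inv′)

  module _ {a b c : Fin n} (a<b : a Fin.< b) (b<c : b Fin.< c) where
    open Triple a<b b<c

    private
      a<c : a Fin.< c
      a<c = Finₚ.<-trans a<b b<c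

      first⇝ac : ∀ {t} → (∀ {u} → D u → OnSide t u) →
                 Shrinks (inverting (first t)) (keeping (first t)) (inverting ac) (keeping ac)
      first⇝ac {abFirst} side = pair-shrinks a<b a<c (ac≢first abFirst) (proj₂ ∘ side)
      first⇝ac {bcFirst} side = pair-shrinks b<c a<c (ac≢first bcFirst) (proj₂ ∘ side)

      ac⇝last : ∀ {t} → (∀ {u} → D u → OnSide t u) →
                Shrinks (inverting ac) (keeping ac) (inverting (last t)) (keeping (last t))
      ac⇝last {abFirst} side = pair-shrinks a<c b<c (ac≢last abFirst ∘ sym) (proj₁ ∘ side)
      ac⇝last {bcFirst} side = pair-shrinks a<c a<b (ac≢last bcFirst ∘ sym) (proj₁ ∘ side)

    -- With the votes read backwards, the chain bcFirst becomes the chain abFirst of the triple c, b, a.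
    private
      module OnAbFirst (side : ∀ {u} → D u → OnSide abFirst u) =
        ChainMajority (votes ρ) (first⇝ac {abFirst} side) (ac⇝last {abFirst} side) (votes-pos-id a<b)
      module OnBcFirst (side : ∀ {u} → D u → OnSide bcFirst u) =
        ChainMajority (flip (votes ρ)) (first⇝ac {bcFirst} side) (ac⇝last {bcFirst} side)
                      (votes-pos-id b<c)

    triple-negTrans : ∀ {x y z} → Arrangement a b c x y z → Majority ρ x y → Majority ρ x z ⊎ Majority ρ z y
    triple-negTrans arr with D-side rw
    ... | abFirst , side = OnAbFirst.negTrans side arr
    ... | bcFirst , side = swap ∘ OnBcFirst.negTrans side (arrangement-reverse arr)

    triple-noTwoTies : Tie (Majority ρ) a b → Tie (Majority ρ) b c → ⊥
    triple-noTwoTies tie-ab tie-bc with D-side rw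
    ... | abFirst , side = OnAbFirst.noTwoTies side tie-ab tie-bc
    ... | bcFirst , side = OnBcFirst.noTwoTies side tie-bc tie-ab

  arrange : ∀ {x y z : Fin n} → x ≢ y → y ≢ z → x ≢ z →
            ∃[ a ] ∃[ b ] ∃[ c ] (a Fin.< b × b Fin.< c × Arrangement a b c x y z)
  arrange {x} {y} {z} x≢y y≢z x≢z with <-cmp x y | <-cmp y z | <-cmp x z
  ... | tri≈ _ x≡y _ | _ | _ = contradiction x≡y x≢y
  ... | _ | tri≈ _ y≡z _ | _ = contradiction y≡z y≢z
  ... | _ | _ | tri≈ _ x≡z _ = contradiction x≡z x≢z
  ... | tri< x<y _ _ | tri< y<z _ _ | _            = x , y , z , x<y , y<z , pqr
  ... | tri< x<y _ _ | tri> _ _ z<y | tri< x<z _ _ = x , z , y , x<z , z<y , prq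
  ... | tri< x<y _ _ | tri> _ _ z<y | tri> _ _ z<x = z , x , y , z<x , x<y , qrp
  ... | tri> _ _ y<x | tri< y<z _ _ | tri< x<z _ _ = y , x , z , y<x , x<z , qpr
  ... | tri> _ _ y<x | tri< y<z _ _ | tri> _ _ z<x = y , z , x , y<z , z<x , rpq
  ... | tri> _ _ y<x | tri> _ _ z<y | _            = z , y , x , z<y , y<x , rqp

  majority-negTrans : ∀ {x y} z → Majority ρ x y → Majority ρ x z ⊎ Majority ρ z y
  majority-negTrans {x} {y} z x◁y with z Finₚ.≟ x | z Finₚ.≟ y
  ... | yes refl | _        = inj₂ x◁y
  ... | no _     | yes refl = inj₁ x◁y
  ... | no z≢x   | no z≢y
    with a , b , c , a<b , b<c , arr ← arrange (λ { refl → <-irrefl refl x◁y }) (z≢y ∘ sym) (z≢x ∘ sym) =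
    triple-negTrans a<b b<c arr x◁y

corollary1p4 : (n : ℕ) (ρ : VoteTally n) (w : Vec (Fin n) n) (𝐢 : List ℕ) →
    ReducedWord w 𝐢 →
    (∀ (u : S n) → (ρ u > 0) ⇔ InPre n 𝐢 (proj₁ u)) →
    IsPrelinearSimpleTies (Majority ρ)
corollary1p4 n ρ w 𝐢 rw support =
  strictWeakOrder⇒prelinearSimpleTies (λ x y → votes ρ y x <? votes ρ x y) <-asym majority-negTrans triple-noTwoTies
  where open TilingMajority ρ rw support
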